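{- Let $a\ge 2$ and $b\ge 1$ be integers. Let $V=\{x\in\mathbb{R}^a:\sum_i x_i=0\}$ with the standard inner product, let $e_1,\dots,e_a$ be the standard basis of $\mathbb{R}^a$, and let $\Lambda\subset V$ be the image of $\mathbb{Z}^a$ under orthogonal projection onto $V$ (the weight lattice of $\mathfrak{sl}_a$). For $1\le i\le a-1$ let $\omega_i=\sum_{j=1}^i e_j-\frac{i}{a}\sum_{j=1}^a e_j$, let $\rho^\vee=\sum_{i=1}^{a-1}\omega_i$, and let $\mathcal{A}$ be the simplex with vertices $0,\omega_1,\dots,\omega_{a-1}$. Let $c$ be the linear map of $\mathbb{R}^a$ with $c(e_i)=e_{i-1}$ (indices modulo $a$), i.e. the permutation matrix of the long cycle $(a,a-1,\dots,1)$. Let $M$ be the set of weights of the irreducible $\mathfrak{sl}_a$-representation of highest weight $b\omega_1$, namely $M=\{m-\frac{b}{a}(1,\dots,1): m\in\mathbb{Z}_{\ge 0}^a,\ \sum_i m_i=b\}$. Then the map \[\phi:\Lambda\cap b\mathcal{A}\to M,\qquad \phi(x)=(1-c)\Big(x-\frac{b\rho^\vee}{a}\Big)\] is a bijection.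
   Context: Here $b\mathcal{A}$ is the $b$-fold dilation of the simplex $\mathcal{A}$ (the fundamental alcove of type $A_{a-1}$), and $a$ is the Coxeter number of $\mathfrak{sl}_a$. In type $A$ the coweight lattice is identified with the weight lattice $\Lambda$. -}

module Defs where

open import Data.Nat as ℕ using (ℕ; zero; suc)
open import Data.Integer as ℤ using (ℤ; +_)
open import Data.Rational as ℚ using (ℚ; 0ℚ; 1ℚ; _+_; _*_; _-_; _/_; _≤_)
open import Data.Fin as Fin using (Fin; toℕ)
open import Data.Product using (Σ; ∃; _×_; proj₁)
open import Data.Bool using (true; false)
open import Relation.Nullary using (yes; no)
open import Relation.Binary.PropositionalEquality using (_≡_)

-- vectors in ℚ^a (all points in the statement have rational coordinates)
Vecℚ : ℕ → Set
Vecℚ a = Fin a → ℚ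

sumF : ∀ {n} → (Fin n → ℚ) → ℚ
sumF {zero}  f = 0ℚ
sumF {suc n} f = f Fin.zero + sumF (λ i → f (Fin.suc i))

sumℕ : ∀ {n} → (Fin n → ℕ) → ℕ
sumℕ {zero}  f = 0
sumℕ {suc n} f = f Fin.zero ℕ.+ sumℕ (λ i → f (Fin.suc i))

sumℤ : ∀ {n} → (Fin n → ℤ) → ℤ
sumℤ {zero}  f = + 0
sumℤ {suc n} f = f Fin.zero ℤ.+ sumℤ (λ i → f (Fin.suc i))

-- z / d as a rational (only used with d = a ≥ 2; value at d = 0 is irrelevant)
frac : ℤ → ℕ → ℚ
frac z zero    = 0ℚ
frac z (suc d) = z / suc d

ℕtoℚ : ℕ → ℚ
ℕtoℚ n = + n / 1

ℤtoℚ : ℤ → ℚ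
ℤtoℚ z = z / 1

_≗ᵥ_ : ∀ {a} → Vecℚ a → Vecℚ a → Set
x ≗ᵥ y = ∀ j → x j ≡ y j

projV : ∀ {a} → (Fin a → ℤ) → Vecℚ a
projV {a} z j = ℤtoℚ (z j) - frac (sumℤ z) a

inΛ : ∀ {a} → Vecℚ a → Set
inΛ {a} x = Σ (Fin a → ℤ) λ z → x ≗ᵥ projV z

-- fundamental weights ω_i = Σ_{j ≤ i} e_j - (i/a) Σ_j e_j, for i = toℕ k
-- (coordinates 0-indexed: coordinate j corresponds to e_{j+1}).
-- For k = 0 this is the zero vector, so the vertices of 𝒜 are ω k, k : Fin a.
ω : (a : ℕ) → Fin a → Vecℚ a
ω a k j = indicator (toℕ j ℕ.<ᵇ toℕ k) - frac (+ toℕ k) a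
  where
  indicator : _ → ℚ
  indicator true  = 1ℚ
  indicator false = 0ℚ

-- ρ^∨ = Σ_{i=1}^{a-1} ω_i  (the ω_0 = 0 term contributes nothing)
ρ∨ : (a : ℕ) → Vecℚ a
ρ∨ a j = sumF (λ k → ω a k j)

inb𝒜 : (a b : ℕ) → Vecℚ a → Set
inb𝒜 a b x =
  Σ (Fin a → ℚ) λ t →
    (∀ k → 0ℚ ≤ t k) × (sumF t ≡ 1ℚ) ×
    (∀ j → x j ≡ sumF (λ k → t k * (ℕtoℚ b * ω a k j)))

-- c(e_i) = e_{i-1} (indices mod a), so (c x)_j = x_{j+1 mod a}
succMod : ∀ {a} → Fin a → Fin a
succMod {suc a} j with toℕ j ℕ.<? a
... | yes p = Fin.fromℕ< (ℕ.s≤s p)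
... | no _ = Fin.zero

cmap : ∀ {a} → Vecℚ a → Vecℚ a
cmap x j = x (succMod j)

oneMinusC : ∀ {a} → Vecℚ a → Vecℚ a
oneMinusC x j = x j - cmap x j

inM : (a b : ℕ) → Vecℚ a → Set
inM a b y = Σ (Fin a → ℕ) λ m → (sumℕ m ≡ b) × (∀ j → y j ≡ ℕtoℚ (m j) - frac (+ b) a)

φ : (a b : ℕ) → Vecℚ a → Vecℚ a
φ a b x = oneMinusC (λ j → x j - frac (+ b) a * ρ∨ a j)

Dom : (a b : ℕ) → Set
Dom a b = Σ (Vecℚ a) λ x → inΛ x × inb𝒜 a b x

IsBijectionΦ : (a b : ℕ) → Set
IsBijectionΦ a b =
  (∀ (x : Dom a b) → inM a b (φ a b (proj₁ x))) ×
  (∀ (x y : Dom a b) → φ a b (proj₁ x) ≗ᵥ φ a b (proj₁ y) →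
      proj₁ x ≗ᵥ proj₁ y) ×
  (∀ y → inM a b y → Σ (Dom a b) λ x → φ a b (proj₁ x) ≗ᵥ y)

-- Write a point of b𝒜 in barycentric coordinates, x = Σ_k t_k (b ω_k) with
-- t_k ≥ 0 and Σ_k t_k = 1.  Since ω_k(j) = [j < k] - k/a, the shift difference
-- ω_k(j) - ω_k(j+1) is δ_{k,j+1} minus a correction at the last coordinate, and
-- the corrections coming from x and from bρ^∨/a cancel.  This gives the key
-- formula (φ-barycentric)
--     φ(x)_j = b t_{j+1} - b/a.
-- From it:
--   * into M:  b t_{j+1} = (x_j - x_{j+1}) + b[j last] is an integer when
--     x ∈ Λ, it is ≥ 0, and these numbers sum to b;
--   * injective: φ(x) determines t, hence x;
--   * onto M: t_k = m_{k-1}/b gives x = Σ_k m_{k-1} ω_k, an integer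
--     combination of fundamental weights and hence a lattice point.

module Submission where

open import Defs
open import Data.Nat using (ℕ; _≤_)

import Data.Nat as ℕ
open import Data.Nat using (zero; suc)
import Data.Nat.Properties as ℕP
open import Data.Integer as ℤ using (ℤ; +_; -[1+_])
import Data.Integer.Properties as ℤP
open import Data.Rational as ℚ using (ℚ; 0ℚ; 1ℚ; _+_; _*_; _-_; -_; 1/_)
import Data.Rational.Properties as ℚP
import Data.Rational.Unnormalised as U
import Data.Rational.Unnormalised.Properties as UP
open import Data.Fin as Fin using (Fin; toℕ)
import Data.Fin.Properties as FinP
open import Data.Product using (Σ; proj₁; _,_)
open import Data.Bool using (Bool; true; false)
open import Data.Empty using (⊥-elim)
open import Relation.Nullary using (yes; no)
open import Relation.Binary.PropositionalEquality
open import Algebra.Bundles using (Ring)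
open import Algebra.Properties.Semiring.Sum (Ring.semiring ℚP.+-*-ring)
  using (sum; sum-cong-≗; ∑-distrib-+; ∑-comm; sum-init-last; sum-replicate-zero; *-distribˡ-sum)
open import Algebra.Properties.Group ℚP.+-0-group using (∙-cancelʳ)
open import Data.Rational.Solver
open +-*-Solver

−-shift-cancel : ∀ u v q → (u - q) - (v - q) ≡ u - v
−-shift-cancel = solve 3 (λ u v q → (u :- q) :- (v :- q) := u :- v) refl

-- The integers inside ℚ: ℤtoℚ z = z / 1 is a ring embedding, proved by
-- computing in the unnormalised rationals where it is the identity.

fromℚᵘ-homo-+ : ∀ u v → ℚ.fromℚᵘ u + ℚ.fromℚᵘ v ≡ ℚ.fromℚᵘ (u U.+ v)
fromℚᵘ-homo-+ u v = ℚP.toℚᵘ-injective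
  (UP.≃-trans (ℚP.toℚᵘ-homo-+ (ℚ.fromℚᵘ u) (ℚ.fromℚᵘ v))
  (UP.≃-trans (UP.+-cong (ℚP.toℚᵘ-fromℚᵘ u) (ℚP.toℚᵘ-fromℚᵘ v))
              (UP.≃-sym (ℚP.toℚᵘ-fromℚᵘ (u U.+ v)))))

fromℚᵘ-homo-* : ∀ u v → ℚ.fromℚᵘ u * ℚ.fromℚᵘ v ≡ ℚ.fromℚᵘ (u U.* v)
fromℚᵘ-homo-* u v = ℚP.toℚᵘ-injective
  (UP.≃-trans (ℚP.toℚᵘ-homo-* (ℚ.fromℚᵘ u) (ℚ.fromℚᵘ v))
  (UP.≃-trans (UP.*-cong (ℚP.toℚᵘ-fromℚᵘ u) (ℚP.toℚᵘ-fromℚᵘ v))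
              (UP.≃-sym (ℚP.toℚᵘ-fromℚᵘ (u U.* v)))))

ℤtoℚ-+ : ∀ i j → ℤtoℚ (i ℤ.+ j) ≡ ℤtoℚ i + ℤtoℚ j
ℤtoℚ-+ i j = sym (trans (fromℚᵘ-homo-+ (U.mkℚᵘ i 0) (U.mkℚᵘ j 0))
  (ℚP.fromℚᵘ-cong (U.*≡* {U.mkℚᵘ i 0 U.+ U.mkℚᵘ j 0} {U.mkℚᵘ (i ℤ.+ j) 0}
    (cong₂ (λ u v → (u ℤ.+ v) ℤ.* + 1) (ℤP.*-identityʳ i) (ℤP.*-identityʳ j)))))

ℤtoℚ-* : ∀ i j → ℤtoℚ (i ℤ.* j) ≡ ℤtoℚ i * ℤtoℚ j
ℤtoℚ-* i j = sym (trans (fromℚᵘ-homo-* (U.mkℚᵘ i 0) (U.mkℚᵘ j 0))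
  (ℚP.fromℚᵘ-cong (U.*≡* {U.mkℚᵘ i 0 U.* U.mkℚᵘ j 0} {U.mkℚᵘ (i ℤ.* j) 0} refl)))

ℤtoℚ-− : ∀ i j → ℤtoℚ (i ℤ.- j) ≡ ℤtoℚ i - ℤtoℚ j
ℤtoℚ-− i j = begin
    ℤtoℚ (i ℤ.- j)                  ≡⟨ ℤtoℚ-+ i (ℤ.- j) ⟩
    ℤtoℚ i + ℤtoℚ (ℤ.- j)           ≡⟨ cong (λ u → ℤtoℚ i + ℤtoℚ u) (sym (ℤP.-1*i≡-i j)) ⟩
    ℤtoℚ i + ℤtoℚ (-[1+ 0 ] ℤ.* j)  ≡⟨ cong (λ u → ℤtoℚ i + u) (ℤtoℚ-* -[1+ 0 ] j) ⟩
    ℤtoℚ i + ℤtoℚ -[1+ 0 ] * ℤtoℚ j ≡⟨ cong (λ u → ℤtoℚ i + u) (sym (ℚP.neg-distribˡ-* 1ℚ (ℤtoℚ j))) ⟩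
    ℤtoℚ i - 1ℚ * ℤtoℚ j            ≡⟨ cong (λ u → ℤtoℚ i - u) (ℚP.*-identityˡ (ℤtoℚ j)) ⟩
    ℤtoℚ i - ℤtoℚ j                 ∎
  where open ≡-Reasoning

nonneg-integer-is-natural : ∀ w → ℚ._≤_ 0ℚ (ℤtoℚ w) → ℕtoℚ ℤ.∣ w ∣ ≡ ℤtoℚ w
nonneg-integer-is-natural (+ n) _ = refl
nonneg-integer-is-natural -[1+ n ] 0≤w = ⊥-elim (ℚP.<-irrefl refl (ℚP.<-≤-trans w<0 0≤w))
  where
  w<0 : ℚ._<_ (ℤtoℚ -[1+ n ]) 0ℚ
  w<0 = ℚP.negative⁻¹ _ {{ℚP.neg-pos {ℚ.normalize (suc n) 1} (ℚP.normalize-pos (suc n) 1)}}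

ℤtoℚ-injective : ∀ i j → ℤtoℚ i ≡ ℤtoℚ j → i ≡ j
ℤtoℚ-injective i j e with UP.≃-trans (UP.≃-sym (ℚP.toℚᵘ-fromℚᵘ (U.mkℚᵘ i 0)))
                      (UP.≃-trans (ℚP.toℚᵘ-cong e) (ℚP.toℚᵘ-fromℚᵘ (U.mkℚᵘ j 0)))
... | U.*≡* p = trans (sym (ℤP.*-identityʳ i)) (trans p (ℤP.*-identityʳ j))

ℕtoℚ-injective : ∀ m n → ℕtoℚ m ≡ ℕtoℚ n → m ≡ n
ℕtoℚ-injective m n e = ℤP.+-injective (ℤtoℚ-injective (+ m) (+ n) e)

frac-spec : ∀ z d → ℕtoℚ (suc d) * frac z (suc d) ≡ ℤtoℚ z
frac-spec z d = trans (fromℚᵘ-homo-* (U.mkℚᵘ (+ suc d) 0) (U.mkℚᵘ z d))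
  (ℚP.fromℚᵘ-cong (U.*≡* {U.mkℚᵘ (+ suc d) 0 U.* U.mkℚᵘ z d} {U.mkℚᵘ z 0}
    (trans (ℤP.*-identityʳ _) (trans (ℤP.*-comm (+ suc d) z)
      (cong (λ n → z ℤ.* + n) (sym (ℕP.+-identityʳ (suc d))))))))

ℕtoℚ-nonZero : ∀ d → ℚ.NonZero (ℕtoℚ (suc d))
ℕtoℚ-nonZero d = ℚP.pos⇒nonZero (ℕtoℚ (suc d)) {{ℚP.normalize-pos (suc d) 1}}

ℕtoℚ-*-cancelˡ : ∀ d p q → ℕtoℚ (suc d) * p ≡ ℕtoℚ (suc d) * q → p ≡ q
ℕtoℚ-*-cancelˡ d p q e = trans (sym (undo p)) (trans (cong (r⁻¹ *_) e) (undo q))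
  where
  r = ℕtoℚ (suc d)
  r⁻¹ = (1/ r) {{ℕtoℚ-nonZero d}}
  undo : ∀ p → r⁻¹ * (r * p) ≡ p
  undo p = trans (sym (ℚP.*-assoc r⁻¹ r p))
    (trans (cong (_* p) (ℚP.*-inverseˡ r {{ℕtoℚ-nonZero d}})) (ℚP.*-identityˡ p))

ℕtoℚ-nonNeg : ∀ n p → ℚ._≤_ 0ℚ p → ℚ._≤_ 0ℚ (ℕtoℚ n * p)
ℕtoℚ-nonNeg n p 0≤p = ℚP.nonNegative⁻¹ _
  {{ℚP.nonNeg*nonNeg⇒nonNeg (ℕtoℚ n) {{ℚP.normalize-nonNeg n 1}} p {{ℚ.nonNegative 0≤p}}}}

ℕtoℚ-suc : ∀ n → ℕtoℚ (suc n) ≡ 1ℚ + ℕtoℚ n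
ℕtoℚ-suc n = ℤtoℚ-+ (+ 1) (+ n)

sum-cong : ∀ {n} {f g : Fin n → ℚ} → (∀ k → f k ≡ g k) → sum f ≡ sum g
sum-cong = sum-cong-≗

sumF≡sum : ∀ {n} (f : Fin n → ℚ) → sumF f ≡ sum f
sumF≡sum {zero}  f = refl
sumF≡sum {suc n} f = cong (λ u → f Fin.zero + u) (sumF≡sum (λ i → f (Fin.suc i)))

sum-neg : ∀ {n} (f : Fin n → ℚ) → sum (λ k → - f k) ≡ - sum f
sum-neg {zero}  f = refl
sum-neg {suc n} f = trans (cong (λ u → - f Fin.zero + u) (sum-neg (λ k → f (Fin.suc k))))
  (sym (ℚP.neg-distrib-+ (f Fin.zero) (sum (λ k → f (Fin.suc k)))))

sum-− : ∀ {n} (f g : Fin n → ℚ) → sum (λ k → f k - g k) ≡ sum f - sum g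
sum-− f g = trans (∑-distrib-+ f (λ k → - g k)) (cong (λ u → sum f + u) (sum-neg g))

sum-ones : ∀ n → sum {n} (λ _ → 1ℚ) ≡ ℕtoℚ n
sum-ones zero    = refl
sum-ones (suc n) = trans (cong (λ u → 1ℚ + u) (sum-ones n)) (sym (ℕtoℚ-suc n))

sumℤ-homo : ∀ {n} (g : Fin n → ℤ) → ℤtoℚ (sumℤ g) ≡ sum (λ k → ℤtoℚ (g k))
sumℤ-homo {zero}  g = refl
sumℤ-homo {suc n} g = trans (ℤtoℚ-+ (g Fin.zero) (sumℤ (λ k → g (Fin.suc k))))
  (cong (λ u → ℤtoℚ (g Fin.zero) + u) (sumℤ-homo (λ k → g (Fin.suc k))))

sumℕ-homo : ∀ {n} (g : Fin n → ℕ) → ℕtoℚ (sumℕ g) ≡ sum (λ k → ℕtoℚ (g k))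
sumℕ-homo {zero}  g = refl
sumℕ-homo {suc n} g = trans (ℤtoℚ-+ (+ g Fin.zero) (+ sumℕ (λ k → g (Fin.suc k))))
  (cong (λ u → ℕtoℚ (g Fin.zero) + u) (sumℕ-homo (λ k → g (Fin.suc k))))

predMod : ∀ {n} → Fin (suc n) → Fin (suc n)
predMod {n} Fin.zero    = Fin.fromℕ n
predMod     (Fin.suc i) = Fin.inject₁ i

succMod-predMod : ∀ {n} (k : Fin (suc n)) → succMod (predMod k) ≡ k
succMod-predMod {n} Fin.zero with toℕ (Fin.fromℕ n) ℕ.<? n
... | yes p = ⊥-elim (ℕP.<-irrefl (FinP.toℕ-fromℕ n) p)
... | no _  = refl
succMod-predMod {n} (Fin.suc i) with toℕ (Fin.inject₁ i) ℕ.<? n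
... | yes p = cong Fin.suc (FinP.toℕ-injective (trans (FinP.toℕ-fromℕ< p) (FinP.toℕ-inject₁ i)))
... | no q  = ⊥-elim (q (subst (ℕ._< n) (sym (FinP.toℕ-inject₁ i)) (FinP.toℕ<n i)))

predMod-succMod : ∀ {n} (j : Fin (suc n)) → predMod (succMod j) ≡ j
predMod-succMod {n} j with toℕ j ℕ.<? n
... | yes p = FinP.toℕ-injective (trans (FinP.toℕ-inject₁ _) (FinP.toℕ-fromℕ< p))
... | no q  = FinP.toℕ-injective (trans (FinP.toℕ-fromℕ n)
                (ℕP.≤-antisym (ℕP.≮⇒≥ q) (ℕP.≤-pred (FinP.toℕ<n j))))

sum-predMod : ∀ {n} (f : Fin (suc n) → ℚ) → sum (λ k → f (predMod k)) ≡ sum f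
sum-predMod f = trans (ℚP.+-comm (f (Fin.fromℕ _)) _) (sym (sum-init-last f))

sum-succMod : ∀ {n} (f : Fin (suc n) → ℚ) → sum (λ k → f (succMod k)) ≡ sum f
sum-succMod f = trans (sym (sum-predMod (λ k → f (succMod k))))
  (sum-cong (λ k → cong f (succMod-predMod k)))

indicator : Bool → ℚ
indicator true  = 1ℚ
indicator false = 0ℚ

indicatorℤ : Bool → ℤ
indicatorℤ true  = + 1
indicatorℤ false = + 0

ℤtoℚ-indicator : ∀ β → ℤtoℚ (indicatorℤ β) ≡ indicator β
ℤtoℚ-indicator true  = refl
ℤtoℚ-indicator false = refl

δ : ∀ {n} → Fin n → Fin n → ℚ
δ k i = indicator (toℕ k ℕ.≡ᵇ toℕ i)

sum-δ : ∀ {n} (f : Fin n → ℚ) (i : Fin n) → sum (λ k → f k * δ k i) ≡ f i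
sum-δ {suc n} f Fin.zero = begin
    f Fin.zero * 1ℚ + sum (λ k → f (Fin.suc k) * 0ℚ)
  ≡⟨ cong₂ _+_ (ℚP.*-identityʳ (f Fin.zero)) (sum-cong (λ k → ℚP.*-zeroʳ (f (Fin.suc k)))) ⟩
    f Fin.zero + sum {n} (λ _ → 0ℚ)
  ≡⟨ cong (λ u → f Fin.zero + u) (sum-replicate-zero n) ⟩
    f Fin.zero + 0ℚ
  ≡⟨ ℚP.+-identityʳ _ ⟩
    f Fin.zero
  ∎
  where open ≡-Reasoning
sum-δ {suc n} f (Fin.suc i) =
  trans (cong₂ _+_ (ℚP.*-zeroʳ (f Fin.zero)) (sum-δ (λ k → f (Fin.suc k)) i)) (ℚP.+-identityˡ _)

sum-below : ∀ n K → K ℕ.≤ n → sum {n} (λ j → indicator (toℕ j ℕ.<ᵇ K)) ≡ ℕtoℚ K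
sum-below n zero _ = sum-replicate-zero n
sum-below (suc n) (suc K) (ℕ.s≤s K≤n) =
  trans (cong (λ u → 1ℚ + u) (sum-below n K K≤n)) (sym (ℕtoℚ-suc K))

ω-eq : ∀ a (k j : Fin a) → ω a k j ≡ indicator (toℕ j ℕ.<ᵇ toℕ k) - frac (+ toℕ k) a
ω-eq a k j with toℕ j ℕ.<ᵇ toℕ k
... | true  = refl
... | false = refl

-- The indicator of the last coordinate j = a-1, decided as in succMod.
isLastᵇ : ∀ {n} → Fin (suc n) → Bool
isLastᵇ {n} j with toℕ j ℕ.<? n
... | yes _ = false
... | no _  = true

isLast : ∀ {n} → Fin (suc n) → ℚ
isLast j = indicator (isLastᵇ j)

indicator-step : ∀ J K → indicator (J ℕ.<ᵇ K) - indicator (suc J ℕ.<ᵇ K) ≡ indicator (K ℕ.≡ᵇ suc J)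
indicator-step J       zero          = refl
indicator-step zero    (suc zero)    = refl
indicator-step zero    (suc (suc K)) = refl
indicator-step (suc J) (suc K)       = indicator-step J K

indicator-wrap : ∀ K → indicator false - indicator (0 ℕ.<ᵇ K) ≡ indicator (K ℕ.≡ᵇ 0) - 1ℚ
indicator-wrap zero    = refl
indicator-wrap (suc K) = refl

<ᵇ-false : ∀ J K → K ℕ.≤ J → (J ℕ.<ᵇ K) ≡ false
<ᵇ-false J       zero    _             = refl
<ᵇ-false (suc J) (suc K) (ℕ.s≤s K≤J) = <ᵇ-false J K K≤J

indicator-shift : ∀ {n} (j k : Fin (suc n)) →
  indicator (toℕ j ℕ.<ᵇ toℕ k) - indicator (toℕ (succMod j) ℕ.<ᵇ toℕ k) ≡ δ k (succMod j) - isLast j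
indicator-shift {n} j k with toℕ j ℕ.<? n
... | yes j<n rewrite FinP.toℕ-fromℕ< (ℕ.s≤s j<n) =
  trans (indicator-step (toℕ j) (toℕ k)) (sym (ℚP.+-identityʳ _))
... | no j≮n rewrite sym (ℕP.≤-antisym (ℕP.≮⇒≥ j≮n) (ℕP.≤-pred (FinP.toℕ<n j)))
                   | <ᵇ-false n (toℕ k) (ℕP.≤-pred (FinP.toℕ<n k)) = indicator-wrap (toℕ k)

ω-shift-difference : ∀ {n} (j k : Fin (suc n)) →
  ω (suc n) k j - ω (suc n) k (succMod j) ≡ δ k (succMod j) - isLast j
ω-shift-difference {n} j k = begin
    ω (suc n) k j - ω (suc n) k (succMod j)  ≡⟨ cong₂ _-_ (ω-eq (suc n) k j) (ω-eq (suc n) k (succMod j)) ⟩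
    (I j - c) - (I (succMod j) - c)          ≡⟨ −-shift-cancel (I j) (I (succMod j)) c ⟩
    I j - I (succMod j)                      ≡⟨ indicator-shift j k ⟩
    δ k (succMod j) - isLast j               ∎
  where
  open ≡-Reasoning
  I : Fin (suc n) → ℚ
  I i = indicator (toℕ i ℕ.<ᵇ toℕ k)
  c = frac (+ toℕ k) (suc n)

ω-weighted-difference : ∀ {n} (g : Fin (suc n) → ℚ) (j : Fin (suc n)) →
  sum (λ k → g k * (ω (suc n) k j - ω (suc n) k (succMod j))) ≡ g (succMod j) - isLast j * sum g
ω-weighted-difference g j = begin
    sum (λ k → g k * (ω _ k j - ω _ k j'))
  ≡⟨ sum-cong (λ k → cong (g k *_) (ω-shift-difference j k)) ⟩
    sum (λ k → g k * (δ k j' - isLast j))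
  ≡⟨ sum-cong (λ k → solve 3 (λ g d l → g :* (d :- l) := g :* d :- l :* g) refl (g k) (δ k j') (isLast j)) ⟩
    sum (λ k → g k * δ k j' - isLast j * g k)
  ≡⟨ sum-− (λ k → g k * δ k j') (λ k → isLast j * g k) ⟩
    sum (λ k → g k * δ k j') - sum (λ k → isLast j * g k)
  ≡⟨ cong₂ _-_ (sum-δ g j') (sym (*-distribˡ-sum (isLast j) g)) ⟩
    g j' - isLast j * sum g
  ∎
  where
  open ≡-Reasoning
  j' = succMod j

ρ∨-shift-difference : ∀ {n} (j : Fin (suc n)) →
  ρ∨ (suc n) j - ρ∨ (suc n) (succMod j) ≡ 1ℚ - isLast j * ℕtoℚ (suc n)
ρ∨-shift-difference {n} j = begin
    ρ∨ A j - ρ∨ A j'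
  ≡⟨ cong₂ _-_ (sumF≡sum (λ k → ω A k j)) (sumF≡sum (λ k → ω A k j')) ⟩
    sum (λ k → ω A k j) - sum (λ k → ω A k j')
  ≡⟨ sym (sum-− (λ k → ω A k j) (λ k → ω A k j')) ⟩
    sum (λ k → ω A k j - ω A k j')
  ≡⟨ sum-cong (λ k → sym (ℚP.*-identityˡ (ω A k j - ω A k j'))) ⟩
    sum (λ k → 1ℚ * (ω A k j - ω A k j'))
  ≡⟨ ω-weighted-difference (λ _ → 1ℚ) j ⟩
    1ℚ - isLast j * sum {A} (λ _ → 1ℚ)
  ≡⟨ cong (λ u → 1ℚ - isLast j * u) (sum-ones A) ⟩
    1ℚ - isLast j * ℕtoℚ A
  ∎
  where
  open ≡-Reasoning
  A = suc n
  j' = succMod j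

barycentric-shift-difference : ∀ {n} b (x t : Fin (suc n) → ℚ) → sumF t ≡ 1ℚ →
  (∀ j → x j ≡ sumF (λ k → t k * (ℕtoℚ b * ω (suc n) k j))) →
  ∀ j → x j - x (succMod j) ≡ ℕtoℚ b * (t (succMod j) - isLast j)
barycentric-shift-difference {n} b x t Σt≡1 x≡ j = begin
    x j - x j'
  ≡⟨ cong₂ _-_ (trans (x≡ j) (sumF≡sum (λ k → t k * (B * ω A k j))))
               (trans (x≡ j') (sumF≡sum (λ k → t k * (B * ω A k j')))) ⟩
    sum (λ k → t k * (B * ω A k j)) - sum (λ k → t k * (B * ω A k j'))
  ≡⟨ sym (sum-− (λ k → t k * (B * ω A k j)) (λ k → t k * (B * ω A k j'))) ⟩
    sum (λ k → t k * (B * ω A k j) - t k * (B * ω A k j'))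
  ≡⟨ sum-cong (λ k → solve 4 (λ t B w w' → t :* (B :* w) :- t :* (B :* w') := B :* (t :* (w :- w'))) refl
       (t k) B (ω A k j) (ω A k j')) ⟩
    sum (λ k → B * (t k * (ω A k j - ω A k j')))
  ≡⟨ sym (*-distribˡ-sum B (λ k → t k * (ω A k j - ω A k j'))) ⟩
    B * sum (λ k → t k * (ω A k j - ω A k j'))
  ≡⟨ cong (B *_) (ω-weighted-difference t j) ⟩
    B * (t j' - isLast j * sum t)
  ≡⟨ cong (λ u → B * (t j' - isLast j * u)) (trans (sym (sumF≡sum t)) Σt≡1) ⟩
    B * (t j' - isLast j * 1ℚ)
  ≡⟨ cong (λ u → B * (t j' - u)) (ℚP.*-identityʳ (isLast j)) ⟩
    B * (t j' - isLast j)
  ∎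
  where
  open ≡-Reasoning
  A = suc n
  B = ℕtoℚ b
  j' = succMod j

-- The key formula:  φ(x)_j = b t_{j+1} - b/a.  The [j last] terms coming from
-- x and from bρ^∨/a cancel because a · (b/a) = b.
φ-barycentric : ∀ {n} b (x t : Fin (suc n) → ℚ) → sumF t ≡ 1ℚ →
  (∀ j → x j ≡ sumF (λ k → t k * (ℕtoℚ b * ω (suc n) k j))) →
  ∀ j → φ (suc n) b x j ≡ ℕtoℚ b * t (succMod j) - frac (+ b) (suc n)
φ-barycentric {n} b x t Σt≡1 x≡ j = begin
    φ A b x j
  ≡⟨ solve 5 (λ xj xj' q ρj ρj' → (xj :- q :* ρj) :- (xj' :- q :* ρj') := (xj :- xj') :- q :* (ρj :- ρj')) refl
       (x j) (x j') q (ρ∨ A j) (ρ∨ A j') ⟩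
    (x j - x j') - q * (ρ∨ A j - ρ∨ A j')
  ≡⟨ cong₂ (λ u v → u - q * v) (barycentric-shift-difference b x t Σt≡1 x≡ j) (ρ∨-shift-difference j) ⟩
    B * (t j' - L) - q * (1ℚ - L * ℕtoℚ A)
  ≡⟨ solve 5 (λ B t' L q A → B :* (t' :- L) :- q :* (con 1ℚ :- L :* A) := (B :* t' :- q) :+ L :* (A :* q :- B)) refl
       B (t j') L q (ℕtoℚ A) ⟩
    (B * t j' - q) + L * (ℕtoℚ A * q - B)
  ≡⟨ cong (λ u → (B * t j' - q) + L * (u - B)) (frac-spec (+ b) n) ⟩
    (B * t j' - q) + L * (B - B)
  ≡⟨ solve 4 (λ X q L B → (X :- q) :+ L :* (B :- B) := X :- q) refl (B * t j') q L B ⟩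
    B * t j' - q
  ∎
  where
  open ≡-Reasoning
  A = suc n
  B = ℕtoℚ b
  q = frac (+ b) A
  L = isLast j
  j' = succMod j

inΛ-difference : ∀ {a} {x : Vecℚ a} → ((z , _) : inΛ x) →
  ∀ i j → x i - x j ≡ ℤtoℚ (z i ℤ.- z j)
inΛ-difference {a} {x} (z , x≡) i j = begin
    x i - x j                                ≡⟨ cong₂ _-_ (x≡ i) (x≡ j) ⟩
    (ℤtoℚ (z i) - q) - (ℤtoℚ (z j) - q)      ≡⟨ −-shift-cancel (ℤtoℚ (z i)) (ℤtoℚ (z j)) q ⟩
    ℤtoℚ (z i) - ℤtoℚ (z j)                  ≡⟨ sym (ℤtoℚ-− (z i) (z j)) ⟩
    ℤtoℚ (z i ℤ.- z j)                       ∎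
  where
  open ≡-Reasoning
  q = frac (sumℤ z) a

inΛ-cong : ∀ {a} {x y : Vecℚ a} → x ≗ᵥ y → inΛ y → inΛ x
inΛ-cong x≗y (z , y≡) = z , λ j → trans (x≗y j) (y≡ j)

inΛ-intro : ∀ {n} (x : Vecℚ (suc n)) (z : Fin (suc n) → ℤ) (q : ℚ) →
  (∀ j → x j ≡ ℤtoℚ (z j) - q) → ℕtoℚ (suc n) * q ≡ ℤtoℚ (sumℤ z) → inΛ x
inΛ-intro {n} x z q x≡ aq≡Σz = z , λ j → trans (x≡ j) (cong (λ u → ℤtoℚ (z j) - u) q≡Σz/a)
  where
  q≡Σz/a : q ≡ frac (sumℤ z) (suc n)
  q≡Σz/a = ℕtoℚ-*-cancelˡ n q _ (trans aq≡Σz (sym (frac-spec (sumℤ z) n)))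

-- Every integer combination Σ_k c_k ω_k of fundamental weights lies in Λ: it is
-- the projection of z with z_j = Σ_{k > j} c_k, shifted by q = Σ_k c_k k/a.
weight-combination-inΛ : ∀ {n} (c : Fin (suc n) → ℤ) →
  inΛ (λ j → sum (λ k → ℤtoℚ (c k) * ω (suc n) k j))
weight-combination-inΛ {n} c = inΛ-intro _ z q x≡ aq≡Σz
  where
  open ≡-Reasoning
  A = suc n
  C : Fin A → ℚ
  C k = ℤtoℚ (c k)
  I : Fin A → Fin A → ℚ
  I j k = indicator (toℕ j ℕ.<ᵇ toℕ k)
  z : Fin A → ℤ
  z j = sumℤ (λ k → c k ℤ.* indicatorℤ (toℕ j ℕ.<ᵇ toℕ k))
  q : ℚ
  q = sum (λ k → C k * frac (+ toℕ k) A)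

  z≡ : ∀ j → ℤtoℚ (z j) ≡ sum (λ k → C k * I j k)
  z≡ j = trans (sumℤ-homo (λ k → c k ℤ.* indicatorℤ (toℕ j ℕ.<ᵇ toℕ k))) (sum-cong (λ k →
    trans (ℤtoℚ-* (c k) (indicatorℤ (toℕ j ℕ.<ᵇ toℕ k)))
          (cong (C k *_) (ℤtoℚ-indicator (toℕ j ℕ.<ᵇ toℕ k)))))

  x≡ : ∀ j → sum (λ k → C k * ω A k j) ≡ ℤtoℚ (z j) - q
  x≡ j = begin
      sum (λ k → C k * ω A k j)
    ≡⟨ sum-cong (λ k → cong (C k *_) (ω-eq A k j)) ⟩
      sum (λ k → C k * (I j k - frac (+ toℕ k) A))
    ≡⟨ sum-cong (λ k → ℚP.*-distribˡ-+ (C k) (I j k) (- frac (+ toℕ k) A)) ⟩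
      sum (λ k → C k * I j k + C k * - frac (+ toℕ k) A)
    ≡⟨ sum-cong (λ k → cong (λ u → C k * I j k + u) (sym (ℚP.neg-distribʳ-* (C k) (frac (+ toℕ k) A)))) ⟩
      sum (λ k → C k * I j k - C k * frac (+ toℕ k) A)
    ≡⟨ sum-− (λ k → C k * I j k) (λ k → C k * frac (+ toℕ k) A) ⟩
      sum (λ k → C k * I j k) - q
    ≡⟨ cong (_- q) (sym (z≡ j)) ⟩
      ℤtoℚ (z j) - q
    ∎

  -- both a q and Σ_j z_j equal Σ_k c_k k
  aq≡ : ℕtoℚ A * q ≡ sum (λ k → C k * ℕtoℚ (toℕ k))
  aq≡ = trans (*-distribˡ-sum (ℕtoℚ A) (λ k → C k * frac (+ toℕ k) A)) (sum-cong (λ k → begin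
      ℕtoℚ A * (C k * frac (+ toℕ k) A)  ≡⟨ solve 3 (λ a c f → a :* (c :* f) := c :* (a :* f)) refl (ℕtoℚ A) (C k) (frac (+ toℕ k) A) ⟩
      C k * (ℕtoℚ A * frac (+ toℕ k) A)  ≡⟨ cong (C k *_) (frac-spec (+ toℕ k) n) ⟩
      C k * ℕtoℚ (toℕ k)                 ∎))

  Σz≡ : ℤtoℚ (sumℤ z) ≡ sum (λ k → C k * ℕtoℚ (toℕ k))
  Σz≡ = begin
      ℤtoℚ (sumℤ z)                        ≡⟨ sumℤ-homo z ⟩
      sum (λ j → ℤtoℚ (z j))               ≡⟨ sum-cong z≡ ⟩
      sum (λ j → sum (λ k → C k * I j k))  ≡⟨ ∑-comm (λ j k → C k * I j k) ⟩
      sum (λ k → sum (λ j → C k * I j k))  ≡⟨ sum-cong (λ k → sym (*-distribˡ-sum (C k) (λ j → I j k))) ⟩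
      sum (λ k → C k * sum (λ j → I j k))  ≡⟨ sum-cong (λ k → cong (C k *_) (sum-below A (toℕ k) (k<a k))) ⟩
      sum (λ k → C k * ℕtoℚ (toℕ k))       ∎
    where
    k<a : ∀ k → toℕ k ℕ.≤ A
    k<a k = ℕP.<⇒≤ (FinP.toℕ<n k)

  aq≡Σz : ℕtoℚ A * q ≡ ℤtoℚ (sumℤ z)
  aq≡Σz = trans aq≡ (sym Σz≡)

-- φ maps Λ ∩ b𝒜 into M: φ(x)_j + b/a = b t_{j+1} = (x_j - x_{j+1}) + b [j last]
-- is a non-negative integer, and these sum to b Σ_k t_k = b.
φ-into-M : ∀ {n} b (x : Dom (suc n) b) → inM (suc n) b (φ (suc n) b (proj₁ x))
φ-into-M {n} b (x , x∈Λ@(z , _) , (t , t≥0 , Σt≡1 , x≡)) = m , Σm≡b , φx≡m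
  where
  open ≡-Reasoning
  A = suc n
  B = ℕtoℚ b

  w : Fin A → ℤ
  w j = (z j ℤ.- z (succMod j)) ℤ.+ + b ℤ.* indicatorℤ (isLastᵇ j)

  w≡ : ∀ j → ℤtoℚ (w j) ≡ B * t (succMod j)
  w≡ j = begin
      ℤtoℚ (w j)
    ≡⟨ ℤtoℚ-+ (z j ℤ.- z j') (+ b ℤ.* indicatorℤ (isLastᵇ j)) ⟩
      ℤtoℚ (z j ℤ.- z j') + ℤtoℚ (+ b ℤ.* indicatorℤ (isLastᵇ j))
    ≡⟨ cong₂ _+_ (sym (inΛ-difference x∈Λ j j'))
                 (trans (ℤtoℚ-* (+ b) (indicatorℤ (isLastᵇ j))) (cong (B *_) (ℤtoℚ-indicator (isLastᵇ j)))) ⟩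
      (x j - x j') + B * isLast j
    ≡⟨ cong (_+ B * isLast j) (barycentric-shift-difference b x t Σt≡1 x≡ j) ⟩
      B * (t j' - isLast j) + B * isLast j
    ≡⟨ solve 3 (λ B t L → B :* (t :- L) :+ B :* L := B :* t) refl B (t j') (isLast j) ⟩
      B * t j'
    ∎
    where j' = succMod j

  m : Fin A → ℕ
  m j = ℤ.∣ w j ∣

  m≡ : ∀ j → ℕtoℚ (m j) ≡ B * t (succMod j)
  m≡ j = trans (nonneg-integer-is-natural (w j) 0≤w) (w≡ j)
    where
    0≤w : ℚ._≤_ 0ℚ (ℤtoℚ (w j))
    0≤w = subst (ℚ._≤_ 0ℚ) (sym (w≡ j)) (ℕtoℚ-nonNeg b (t (succMod j)) (t≥0 (succMod j)))

  Σm≡b : sumℕ m ≡ b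
  Σm≡b = ℕtoℚ-injective (sumℕ m) b (begin
      ℕtoℚ (sumℕ m)                  ≡⟨ sumℕ-homo m ⟩
      sum (λ j → ℕtoℚ (m j))         ≡⟨ sum-cong m≡ ⟩
      sum (λ j → B * t (succMod j))  ≡⟨ sym (*-distribˡ-sum B (λ j → t (succMod j))) ⟩
      B * sum (λ j → t (succMod j))  ≡⟨ cong (B *_) (trans (sum-succMod t) (trans (sym (sumF≡sum t)) Σt≡1)) ⟩
      B * 1ℚ                         ≡⟨ ℚP.*-identityʳ B ⟩
      B                              ∎)

  φx≡m : ∀ j → φ A b x j ≡ ℕtoℚ (m j) - frac (+ b) A
  φx≡m j = trans (φ-barycentric b x t Σt≡1 x≡ j) (cong (_- frac (+ b) A) (sym (m≡ j)))

-- φ is injective on Λ ∩ b𝒜 for b ≥ 1: φ(x) determines b t_{j+1} for every j,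
-- hence the barycentric coordinates t, hence x.
φ-injective : ∀ {n} b' (x y : Dom (suc n) (suc b')) →
  φ (suc n) (suc b') (proj₁ x) ≗ᵥ φ (suc n) (suc b') (proj₁ y) → proj₁ x ≗ᵥ proj₁ y
φ-injective {n} b' (x , _ , (t , _ , Σt≡1 , x≡)) (y , _ , (s , _ , Σs≡1 , y≡)) φx≗φy j = begin
    x j                    ≡⟨ trans (x≡ j) (sumF≡sum (λ k → t k * W k)) ⟩
    sum (λ k → t k * W k)  ≡⟨ sum-cong (λ k → cong (_* W k) (t≡s k)) ⟩
    sum (λ k → s k * W k)  ≡⟨ sym (trans (y≡ j) (sumF≡sum (λ k → s k * W k))) ⟩
    y j                    ∎
  where
  open ≡-Reasoning
  b = suc b'
  W : Fin (suc n) → ℚ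
  W k = ℕtoℚ b * ω (suc n) k j

  t≡s-shifted : ∀ i → t (succMod i) ≡ s (succMod i)
  t≡s-shifted i = ℕtoℚ-*-cancelˡ b' _ _ (∙-cancelʳ (- frac (+ b) (suc n)) _ _
    (trans (sym (φ-barycentric b x t Σt≡1 x≡ i)) (trans (φx≗φy i) (φ-barycentric b y s Σs≡1 y≡ i))))

  t≡s : ∀ k → t k ≡ s k
  t≡s k = subst (λ i → t i ≡ s i) (succMod-predMod k) (t≡s-shifted (predMod k))

-- φ maps Λ ∩ b𝒜 onto M for b ≥ 1: given m, the point with barycentric
-- coordinates t_k = m_{k-1}/b is an ℕ-combination of fundamental weights,
-- hence in Λ, and φ sends it to m - b/a.
φ-onto-M : ∀ {n} b' y → inM (suc n) (suc b') y →
  Σ (Dom (suc n) (suc b')) λ x → φ (suc n) (suc b') (proj₁ x) ≗ᵥ y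
φ-onto-M {n} b' y (m , Σm≡b , y≡) = (x , x∈Λ , (t , t≥0 , Σt≡1 , λ _ → refl)) , φx≡y
  where
  open ≡-Reasoning
  A = suc n
  b = suc b'
  B = ℕtoℚ b
  c : Fin A → ℚ
  c k = ℕtoℚ (m (predMod k))

  t : Fin A → ℚ
  t k = frac (+ m (predMod k)) b

  Bt≡c : ∀ k → B * t k ≡ c k
  Bt≡c k = frac-spec (+ m (predMod k)) b'

  t≥0 : ∀ k → ℚ._≤_ 0ℚ (t k)
  t≥0 k = ℚP.nonNegative⁻¹ (t k) {{ℚP.normalize-nonNeg (m (predMod k)) b}}

  Σt≡1 : sumF t ≡ 1ℚ
  Σt≡1 = ℕtoℚ-*-cancelˡ b' (sumF t) 1ℚ (begin
      B * sumF t              ≡⟨ cong (B *_) (sumF≡sum t) ⟩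
      B * sum t               ≡⟨ *-distribˡ-sum B t ⟩
      sum (λ k → B * t k)     ≡⟨ sum-cong Bt≡c ⟩
      sum c                   ≡⟨ sum-predMod (λ k → ℕtoℚ (m k)) ⟩
      sum (λ k → ℕtoℚ (m k))  ≡⟨ sym (sumℕ-homo m) ⟩
      ℕtoℚ (sumℕ m)           ≡⟨ cong ℕtoℚ Σm≡b ⟩
      B                       ≡⟨ sym (ℚP.*-identityʳ B) ⟩
      B * 1ℚ                  ∎)

  x : Vecℚ A
  x j = sumF (λ k → t k * (B * ω A k j))

  x≡combination : ∀ j → x j ≡ sum (λ k → c k * ω A k j)
  x≡combination j = trans (sumF≡sum (λ k → t k * (B * ω A k j))) (sum-cong (λ k →
    trans (solve 3 (λ t B w → t :* (B :* w) := (B :* t) :* w) refl (t k) B (ω A k j))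
          (cong (_* ω A k j) (Bt≡c k))))

  x∈Λ : inΛ x
  x∈Λ = inΛ-cong x≡combination (weight-combination-inΛ (λ k → + m (predMod k)))

  φx≡y : φ A b x ≗ᵥ y
  φx≡y j = begin
      φ A b x j                       ≡⟨ φ-barycentric b x t Σt≡1 (λ _ → refl) j ⟩
      B * t (succMod j) - q           ≡⟨ cong (_- q) (Bt≡c (succMod j)) ⟩
      c (succMod j) - q               ≡⟨ cong (λ i → ℕtoℚ (m i) - q) (predMod-succMod j) ⟩
      ℕtoℚ (m j) - q                  ≡⟨ sym (y≡ j) ⟩
      y j                             ∎
    where q = frac (+ b) A

-- Writing a = n+1 and b = b'+1, the three parts give the bijection
-- (the argument only uses a ≥ 1 and b ≥ 1).
proposition3p3 : (a b : ℕ) → 2 ≤ a → 1 ≤ b → IsBijectionΦ a b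
proposition3p3 (suc n) (suc b') _ _ = φ-into-M (suc b') , φ-injective b' , φ-onto-M b'
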